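{- Let $w\ge1$ and $a,b,r$ be integers with $0\le a,b,r<w$. Consider the $\texttt{xoshiro++}$ generator with $w$ bits of output and $4w$ bits of state: state $(s_0,s_1,s_2,s_3)$ of $w$-bit words, next-state map \[ s'_0=s_0\oplus s_1\oplus s_3,\quad s'_1=s_0\oplus s_1\oplus s_2,\quad s'_2=s_0\oplus s_2\oplus(s_1\ll a),\quad s'_3=\mathrm{rotl}(s_1\oplus s_3,b), \] and output $\mathrm{rotl}(s_0+s_3,r)+s_0$ (the $\texttt{++}$ scrambler on the first and last words of state). Then this generator is $3$-dimensionally equidistributed.
   Context: A $w$-bit word is an element of $\{0,1\}^w$, identified with an integer in $[0,2^w)$. $\oplus$ is bitwise xor, $x\ll a$ is $x\cdot 2^a\bmod 2^w$, $\mathrm{rotl}(x,r)$ is left rotation by $r$ positions, and $+$ between words is addition in $\mathbf Z/2^w\mathbf Z$. A generator with $kw$ bits of state (here $k=4$), next-state map $T$ and $w$-bit output function $\varphi$ is $d$-dimensionally equidistributed ($d\le k$) if, as $s$ ranges over all nonzero states, every $d$-tuple $(\varphi(s),\varphi(Ts),\dots,\varphi(T^{d-1}s))$ appears exactly $2^{w(k-d)}$ times, except the all-zero $d$-tuple, which appears $2^{w(k-d)}-1$ times. -}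

module Defs where

open import Data.Bool using (Bool; true; false; if_then_else_; _xor_)
import Data.Bool.Properties as BoolP
open import Data.Nat using (ℕ; zero; suc; _+_; _*_; _∸_; _^_; _≤ᵇ_; _≡ᵇ_)
open import Data.Nat.DivMod using (_/_; _%_)
open import Data.Fin using (Fin; toℕ)
open import Data.Vec using (Vec; []; _∷_; tabulate; lookup; zipWith; replicate; _++_)
open import Data.Vec.Properties using (≡-dec)
open import Data.List as List using (List; length; filter; concatMap)
open import Data.Product using (_×_; _,_)
open import Relation.Binary.PropositionalEquality using (_≡_; _≢_)
open import Relation.Nullary using (Dec; ¬?)
open import Relation.Nullary.Decidable using (_×-dec_)

-- w-bit words.  Bit i of the vector (index i) has weight 2^i
-- (least significant bit first).

Word : ℕ → Set
Word w = Vec Bool w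

toNat : ∀ {w} → Word w → ℕ
toNat []       = 0
toNat (b ∷ bs) = (if b then 1 else 0) + 2 * toNat bs

fromNat : ∀ w → ℕ → Word w
fromNat zero    n = []
fromNat (suc w) n = ((n % 2) ≡ᵇ 1) ∷ fromNat w (n / 2)

bitAt : ∀ {w} → Word w → ℕ → Bool
bitAt []       _       = false
bitAt (b ∷ bs) zero    = b
bitAt (b ∷ bs) (suc n) = bitAt bs n

_⊕_ : ∀ {w} → Word w → Word w → Word w
_⊕_ = zipWith _xor_
infixl 6 _⊕_ _⊞_

_⊞_ : ∀ {w} → Word w → Word w → Word w
_⊞_ {w} x y = fromNat w (toNat x + toNat y)

shl : ∀ {w} → Word w → ℕ → Word w
shl {w} x a = tabulate λ i → if a ≤ᵇ toℕ i then bitAt x (toℕ i ∸ a) else false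

-- left rotation by r positions (intended for 0 ≤ r < w):
-- bit i of the result is bit (i - r) mod w of x
rotl : ∀ {w} → Word w → ℕ → Word w
rotl {w} x r = tabulate λ i →
  if r ≤ᵇ toℕ i then bitAt x (toℕ i ∸ r) else bitAt x (toℕ i + w ∸ r)

State : ℕ → ℕ → Set
State w k = Vec (Word w) k

zeroWord : ∀ w → Word w
zeroWord w = replicate w false

allVecs : ∀ {A : Set} → List A → ∀ n → List (Vec A n)
allVecs xs zero    = List.[ [] ]
allVecs xs (suc n) = concatMap (λ x → List.map (x ∷_) (allVecs xs n)) xs

allWords : ∀ w → List (Word w)
allWords w = allVecs (true List.∷ false List.∷ List.[]) w

allStates : ∀ w k → List (State w k)
allStates w k = allVecs (allWords w) k

_≟W_ : ∀ {w} (x y : Word w) → Dec (x ≡ y)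
_≟W_ = ≡-dec BoolP._≟_

_≟S_ : ∀ {w k} (x y : State w k) → Dec (x ≡ y)
_≟S_ = ≡-dec _≟W_

outputs : ∀ {w k} → (State w k → State w k) → (State w k → Word w) →
          ∀ d → State w k → Vec (Word w) d
outputs T φ zero    s = []
outputs T φ (suc d) s = φ s ∷ outputs T φ d (T s)

count : ∀ {w k} → (State w k → State w k) → (State w k → Word w) →
        ∀ d → Vec (Word w) d → ℕ
count {w} {k} T φ d t =
  length (filter (λ s → ¬? (s ≟S replicate k (zeroWord w))
                          ×-dec (outputs T φ d s ≟S t))
                 (allStates w k))

Equidistributed : ∀ w k → (State w k → State w k) → (State w k → Word w) →
                  ℕ → Set
Equidistributed w k T φ d =
  ∀ (t : Vec (Word w) d) →
    (t ≢ replicate d (zeroWord w) → count T φ d t ≡ 2 ^ (w * (k ∸ d)))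
    × (t ≡ replicate d (zeroWord w) → count T φ d t ≡ 2 ^ (w * (k ∸ d)) ∸ 1)

xoshiroNext : ∀ {w} → ℕ → ℕ → State w 4 → State w 4
xoshiroNext a b (s₀ ∷ s₁ ∷ s₂ ∷ s₃ ∷ []) =
    (s₀ ⊕ s₁ ⊕ s₃)
  ∷ (s₀ ⊕ s₁ ⊕ s₂)
  ∷ (s₀ ⊕ s₂ ⊕ shl s₁ a)
  ∷ rotl (s₁ ⊕ s₃) b
  ∷ []

plusplus : ∀ {w} → ℕ → State w 4 → Word w
plusplus r (s₀ ∷ s₁ ∷ s₂ ∷ s₃ ∷ []) = rotl (s₀ ⊞ s₃) r ⊞ s₀

-- Write xᵢ and yᵢ for the first and last words of the i-th state and R for rotation by b.
-- The i-th output is rotl (xᵢ ⊞ yᵢ) r ⊞ xᵢ, a bijective function of yᵢ once xᵢ is known,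
-- and one step of the recurrence gives xᵢ = xᵢ₊₁ ⊕ R⁻¹ yᵢ₊₁. Hence from x₂ and the outputs
-- o₂, o₁, o₀ one recovers y₂, x₁, y₁, x₀, y₀ in turn, and from these the whole state.
-- So s ↦ (x₂, o₀, o₁, o₂) is a bijection of the state space fixing 0, and every output
-- triple comes from exactly 2^w states (one for each x₂), except that the zero triple
-- loses the excluded zero state.

module Submission where

open import Data.Bool using (Bool; true; false; if_then_else_; _xor_; T)
import Data.Bool.Properties as Bool
open import Data.Bool.Properties using (xor-assoc; xor-same; xor-identityʳ; if-eta; if-cong₂)
open import Data.Fin using (Fin; toℕ; fromℕ<) renaming (zero to fzero; suc to fsuc)
open import Data.Fin.Properties using (toℕ<n; toℕ-fromℕ<)
open import Data.List using (List; []; _∷_; map; concatMap; length; filter) renaming (_++_ to _++ˡ_)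
open import Data.Nat
open import Data.Nat.DivMod
open import Data.Nat.Divisibility using (divides)
open import Data.Nat.Properties
open import Algebra.Properties.CommutativeSemigroup +-commutativeSemigroup using () renaming (interchange to +-interchange)
open import Data.Product using (_×_; _,_; proj₁; proj₂)
open import Data.Vec using (Vec; []; _∷_; _++_; lookup; replicate; tabulate; drop)
open import Data.Vec.Properties using (≡-dec; ∷-injective; lookup∘tabulate; tabulate∘lookup; tabulate-cong; lookup-replicate)
open import Function.Base using (_∘_)
open import Function.Bundles using (mk⇔; _↔_; Inverse; mk↔ₛ′)
open import Function.Properties.Inverse using (↔-sym)
open import Relation.Binary.Definitions using (DecidableEquality)
open import Relation.Binary.PropositionalEquality
open import Relation.Nullary using (Dec; yes; no; does; ¬_; ¬?)
open import Relation.Nullary.Decidable using (_×-dec_; dec-true; does-⇔)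
open import Relation.Unary using (Pred; Decidable)

open import Defs

⊕-assoc : ∀ {w} (x y z : Word w) → (x ⊕ y) ⊕ z ≡ x ⊕ (y ⊕ z)
⊕-assoc []      []      []      = refl
⊕-assoc (a ∷ x) (b ∷ y) (c ∷ z) = cong₂ _∷_ (xor-assoc a b c) (⊕-assoc x y z)

⊕-cancelʳ : ∀ {w} (x y : Word w) → (x ⊕ y) ⊕ y ≡ x
⊕-cancelʳ []      []      = refl
⊕-cancelʳ (a ∷ x) (b ∷ y) = cong₂ _∷_ a⊕b⊕b≡a (⊕-cancelʳ x y)
  where
  a⊕b⊕b≡a : (a xor b) xor b ≡ a
  a⊕b⊕b≡a = trans (xor-assoc a b b) (trans (cong (a xor_) (xor-same b)) (xor-identityʳ a))

⊕-cancelˡ : ∀ {w} (x y : Word w) → x ⊕ (x ⊕ y) ≡ y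
⊕-cancelˡ []      []      = refl
⊕-cancelˡ (a ∷ x) (b ∷ y) =
  cong₂ _∷_ (trans (sym (xor-assoc a a b)) (cong (_xor b) (xor-same a))) (⊕-cancelˡ x y)

⊕-identityʳ : ∀ {w} (x : Word w) → x ⊕ zeroWord w ≡ x
⊕-identityʳ []      = refl
⊕-identityʳ (a ∷ x) = cong₂ _∷_ (xor-identityʳ a) (⊕-identityʳ x)

-- Words as integers modulo 2 ^ w

bit : Bool → ℕ
bit b = if b then 1 else 0

bit<2 : ∀ b → bit b < 2
bit<2 true  = s≤s (s≤s z≤n)
bit<2 false = s≤s z≤n

toNat<2^w : ∀ {w} (x : Word w) → toNat x < 2 ^ w
toNat<2^w []      = s≤s z≤n
toNat<2^w {suc w} (b ∷ x) = begin-strict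
  bit b + 2 * toNat x  <⟨ +-monoˡ-< (2 * toNat x) (bit<2 b) ⟩
  2 + 2 * toNat x      ≡⟨ sym (*-suc 2 (toNat x)) ⟩
  2 * suc (toNat x)    ≤⟨ *-monoʳ-≤ 2 (toNat<2^w x) ⟩
  2 * 2 ^ w            ∎
  where open ≤-Reasoning

bit-%2 : ∀ n → bit (n % 2 ≡ᵇ 1) ≡ n % 2
bit-%2 n with n % 2 | m%n<n n 2
... | 0 | _ = refl
... | 1 | _ = refl
... | suc (suc _) | s≤s (s≤s ())

toNat-fromNat : ∀ w n → toNat (fromNat w n) ≡ _%_ n (2 ^ w) {{m^n≢0 2 w}}
toNat-fromNat zero    n = sym (n%1≡0 n)
toNat-fromNat (suc w) n = begin
  bit (n % 2 ≡ᵇ 1) + 2 * toNat (fromNat w (n / 2))  ≡⟨ cong₂ (λ b h → b + 2 * h) (bit-%2 n) (toNat-fromNat w (n / 2)) ⟩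
  n % 2 + 2 * (n / 2 % N)                           ≡⟨ cong (n % 2 +_) (*-comm 2 (n / 2 % N)) ⟩
  n % 2 + n / 2 % N * 2                             ≡⟨ cong (n % 2 +_) (m%n*o≡m*o%[n*o] (n / 2) N 2) ⟩
  n % 2 + n / 2 * 2 % (N * 2)                       ≡⟨ +-comm (n % 2) _ ⟩
  n / 2 * 2 % (N * 2) + n % 2                       ≡⟨ [m*n+o]%[p*n]≡[m*n]%[p*n]+o (n / 2) N (m%n<n n 2) ⟨
  (n / 2 * 2 + n % 2) % (N * 2)                     ≡⟨ cong (_% (N * 2)) (trans (m≡m%n+[m/n]*n n 2) (+-comm (n % 2) _)) ⟨
  n % (N * 2)                                       ≡⟨ %-congʳ (*-comm N 2) ⟩
  n % (2 * N)                                       ∎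
  where
  open ≡-Reasoning
  N = 2 ^ w
  instance
    _ = m^n≢0 2 w
    _ = m*n≢0 N 2
    _ = m^n≢0 2 (suc w)

fromNat-toNat : ∀ {w} (x : Word w) → fromNat w (toNat x) ≡ x
fromNat-toNat []                = refl
fromNat-toNat {suc w} (b ∷ x) = cong₂ _∷_ lowBit (trans (cong (fromNat w) highBits) (fromNat-toNat x))
  where
  open ≡-Reasoning
  n = bit b + toNat x * 2
  bit-≡ᵇ : ∀ b → (bit b ≡ᵇ 1) ≡ b
  bit-≡ᵇ true  = refl
  bit-≡ᵇ false = refl
  lowBit : ((bit b + 2 * toNat x) % 2 ≡ᵇ 1) ≡ b
  lowBit = begin
    ((bit b + 2 * toNat x) % 2 ≡ᵇ 1)  ≡⟨ cong (λ t → (bit b + t) % 2 ≡ᵇ 1) (*-comm 2 (toNat x)) ⟩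
    (n % 2 ≡ᵇ 1)                      ≡⟨ cong (_≡ᵇ 1) ([m+kn]%n≡m%n (bit b) (toNat x) 2) ⟩
    (bit b % 2 ≡ᵇ 1)                  ≡⟨ cong (_≡ᵇ 1) (m<n⇒m%n≡m (bit<2 b)) ⟩
    (bit b ≡ᵇ 1)                      ≡⟨ bit-≡ᵇ b ⟩
    b                                 ∎
  highBits : (bit b + 2 * toNat x) / 2 ≡ toNat x
  highBits = begin
    (bit b + 2 * toNat x) / 2  ≡⟨ cong (λ t → (bit b + t) / 2) (*-comm 2 (toNat x)) ⟩
    n / 2                      ≡⟨ +-distrib-/-∣ʳ (bit b) (divides (toNat x) refl) ⟩
    bit b / 2 + toNat x * 2 / 2 ≡⟨ cong₂ _+_ (m<n⇒m/n≡0 (bit<2 b)) (m*n/n≡m (toNat x) 2) ⟩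
    toNat x                    ∎

module _ {w : ℕ} where
  private instance
    2^w≢0 : NonZero (2 ^ w)
    2^w≢0 = m^n≢0 2 w

  _⊟_ : Word w → Word w → Word w
  x ⊟ y = fromNat w (toNat x + (2 ^ w ∸ toNat y))

  fromNat-cong-% : ∀ {m n} → m % 2 ^ w ≡ n % 2 ^ w → fromNat w m ≡ fromNat w n
  fromNat-cong-% {m} {n} eq = begin
    fromNat w m                      ≡⟨ fromNat-toNat (fromNat w m) ⟨
    fromNat w (toNat (fromNat w m))  ≡⟨ cong (fromNat w) (trans (toNat-fromNat w m) (trans eq (sym (toNat-fromNat w n)))) ⟩
    fromNat w (toNat (fromNat w n))  ≡⟨ fromNat-toNat (fromNat w n) ⟩
    fromNat w n                      ∎
    where open ≡-Reasoning

  fromNat-reduce-+ : ∀ m n → fromNat w (toNat (fromNat w m) + n) ≡ fromNat w (m + n)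
  fromNat-reduce-+ m n = fromNat-cong-% (begin
    (toNat (fromNat w m) + n) % 2 ^ w          ≡⟨ cong (λ t → (t + n) % 2 ^ w) (toNat-fromNat w m) ⟩
    (m % 2 ^ w + n) % 2 ^ w                    ≡⟨ %-distribˡ-+ (m % 2 ^ w) n (2 ^ w) ⟩
    (m % 2 ^ w % 2 ^ w + n % 2 ^ w) % 2 ^ w    ≡⟨ cong (λ t → (t + n % 2 ^ w) % 2 ^ w) (m%n%n≡m%n m (2 ^ w)) ⟩
    (m % 2 ^ w + n % 2 ^ w) % 2 ^ w            ≡⟨ %-distribˡ-+ m n (2 ^ w) ⟨
    (m + n) % 2 ^ w                            ∎)
    where open ≡-Reasoning

  fromNat-toNat-+2^w : ∀ (x : Word w) → fromNat w (toNat x + 2 ^ w) ≡ x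
  fromNat-toNat-+2^w x = trans (fromNat-cong-% ([m+n]%n≡m%n (toNat x) (2 ^ w))) (fromNat-toNat x)

  ⊞-comm : ∀ (x y : Word w) → x ⊞ y ≡ y ⊞ x
  ⊞-comm x y = cong (fromNat w) (+-comm (toNat x) (toNat y))

  ⊞-⊟-cancel : ∀ (x y : Word w) → (x ⊞ y) ⊟ y ≡ x
  ⊞-⊟-cancel x y = begin
    fromNat w (toNat (x ⊞ y) + (2 ^ w ∸ toNat y))
      ≡⟨ fromNat-reduce-+ (toNat x + toNat y) _ ⟩
    fromNat w (toNat x + toNat y + (2 ^ w ∸ toNat y))
      ≡⟨ cong (fromNat w) (+-assoc (toNat x) _ _) ⟩
    fromNat w (toNat x + (toNat y + (2 ^ w ∸ toNat y)))
      ≡⟨ cong (λ t → fromNat w (toNat x + t)) (m+[n∸m]≡n (<⇒≤ (toNat<2^w y))) ⟩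
    fromNat w (toNat x + 2 ^ w)
      ≡⟨ fromNat-toNat-+2^w x ⟩
    x ∎
    where open ≡-Reasoning

  ⊟-⊞-cancel : ∀ (x y : Word w) → (x ⊟ y) ⊞ y ≡ x
  ⊟-⊞-cancel x y = begin
    fromNat w (toNat (x ⊟ y) + toNat y)
      ≡⟨ fromNat-reduce-+ (toNat x + (2 ^ w ∸ toNat y)) _ ⟩
    fromNat w (toNat x + (2 ^ w ∸ toNat y) + toNat y)
      ≡⟨ cong (fromNat w) (+-assoc (toNat x) _ _) ⟩
    fromNat w (toNat x + (2 ^ w ∸ toNat y + toNat y))
      ≡⟨ cong (λ t → fromNat w (toNat x + t)) (m∸n+n≡m (<⇒≤ (toNat<2^w y))) ⟩
    fromNat w (toNat x + 2 ^ w)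
      ≡⟨ fromNat-toNat-+2^w x ⟩
    x ∎
    where open ≡-Reasoning

bitAt-toℕ : ∀ {w} (x : Word w) (i : Fin w) → bitAt x (toℕ i) ≡ lookup x i
bitAt-toℕ (b ∷ x) fzero    = refl
bitAt-toℕ (b ∷ x) (fsuc i) = bitAt-toℕ x i

lookup-rotl : ∀ {m} (x : Word (suc m)) {c} → c ≤ suc m → (i : Fin (suc m)) →
              lookup (rotl x c) i ≡ bitAt x ((toℕ i + (suc m ∸ c)) % suc m)
lookup-rotl {m} x {c} c≤w i
  rewrite lookup∘tabulate (λ j → if c ≤ᵇ toℕ j then bitAt x (toℕ j ∸ c) else bitAt x (toℕ j + suc m ∸ c)) i
  with c ≤ᵇ toℕ i in c≤ᵇi
... | true  = cong (bitAt x) (sym (begin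
  (toℕ i + (w ∸ c)) % w          ≡⟨ cong (λ t → (t + (w ∸ c)) % w) (m∸n+n≡m c≤i) ⟨
  (toℕ i ∸ c + c + (w ∸ c)) % w  ≡⟨ cong (_% w) (+-assoc (toℕ i ∸ c) c (w ∸ c)) ⟩
  (toℕ i ∸ c + (c + (w ∸ c))) % w ≡⟨ cong (λ t → (toℕ i ∸ c + t) % w) (m+[n∸m]≡n c≤w) ⟩
  (toℕ i ∸ c + w) % w            ≡⟨ [m+n]%n≡m%n (toℕ i ∸ c) w ⟩
  (toℕ i ∸ c) % w                ≡⟨ m<n⇒m%n≡m (≤-<-trans (m∸n≤m (toℕ i) c) (toℕ<n i)) ⟩
  toℕ i ∸ c                      ∎))
  where
  open ≡-Reasoning
  w = suc m
  c≤i : c ≤ toℕ i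
  c≤i = ≤ᵇ⇒≤ c (toℕ i) (subst T (sym c≤ᵇi) _)
... | false = cong (bitAt x) (trans (+-∸-assoc (toℕ i) c≤w) (sym (m<n⇒m%n≡m i+[w∸c]<w)))
  where
  w = suc m
  i<c : toℕ i < c
  i<c = ≰⇒> (λ c≤i → subst T c≤ᵇi (≤⇒≤ᵇ c≤i))
  i+[w∸c]<w : toℕ i + (w ∸ c) < w
  i+[w∸c]<w = subst (toℕ i + (w ∸ c) <_) (m+[n∸m]≡n c≤w) (+-monoˡ-< (w ∸ c) i<c)

rotl-inverse : ∀ {w} (x : Word w) c d → c + d ≡ w → rotl (rotl x c) d ≡ x
rotl-inverse {zero}  [] _ _ _ = refl
rotl-inverse {suc m} x c d c+d≡w = begin
  rotl (rotl x c) d                          ≡⟨ tabulate∘lookup (rotl (rotl x c) d) ⟨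
  tabulate (lookup (rotl (rotl x c) d))      ≡⟨ tabulate-cong lookup-rotl-rotl ⟩
  tabulate (lookup x)                        ≡⟨ tabulate∘lookup x ⟩
  x                                          ∎
  where
  open ≡-Reasoning
  w = suc m
  c≤w : c ≤ w
  c≤w = subst (c ≤_) c+d≡w (m≤m+n c d)
  d≤w : d ≤ w
  d≤w = subst (d ≤_) c+d≡w (m≤n+m d c)
  j : Fin w → ℕ
  j i = (toℕ i + (w ∸ d)) % w
  j<w : ∀ i → j i < w
  j<w i = m%n<n (toℕ i + (w ∸ d)) w
  index : ∀ i → (j i + (w ∸ c)) % w ≡ toℕ i
  index i = begin
    ((toℕ i + (w ∸ d)) % w + (w ∸ c)) % w  ≡⟨ cong₂ (λ s t → ((toℕ i + s) % w + t) % w) w∸d≡c w∸c≡d ⟩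
    ((toℕ i + c) % w + d) % w              ≡⟨ %-distribˡ-+ ((toℕ i + c) % w) d w ⟩
    ((toℕ i + c) % w % w + d % w) % w      ≡⟨ cong (λ t → (t + d % w) % w) (m%n%n≡m%n (toℕ i + c) w) ⟩
    ((toℕ i + c) % w + d % w) % w          ≡⟨ %-distribˡ-+ (toℕ i + c) d w ⟨
    (toℕ i + c + d) % w                    ≡⟨ cong (_% w) (trans (+-assoc (toℕ i) c d) (cong (toℕ i +_) c+d≡w)) ⟩
    (toℕ i + w) % w                        ≡⟨ [m+n]%n≡m%n (toℕ i) w ⟩
    toℕ i % w                              ≡⟨ m<n⇒m%n≡m (toℕ<n i) ⟩
    toℕ i                                  ∎
    where
    w∸d≡c : w ∸ d ≡ c
    w∸d≡c = trans (cong (_∸ d) (sym c+d≡w)) (m+n∸n≡m c d)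
    w∸c≡d : w ∸ c ≡ d
    w∸c≡d = trans (cong (_∸ c) (sym c+d≡w)) (m+n∸m≡n c d)
  lookup-rotl-rotl : ∀ i → lookup (rotl (rotl x c) d) i ≡ lookup x i
  lookup-rotl-rotl i = begin
    lookup (rotl (rotl x c) d) i                     ≡⟨ lookup-rotl (rotl x c) d≤w i ⟩
    bitAt (rotl x c) (j i)                           ≡⟨ cong (bitAt (rotl x c)) (toℕ-fromℕ< (j<w i)) ⟨
    bitAt (rotl x c) (toℕ (fromℕ< (j<w i)))          ≡⟨ bitAt-toℕ (rotl x c) (fromℕ< (j<w i)) ⟩
    lookup (rotl x c) (fromℕ< (j<w i))               ≡⟨ lookup-rotl x c≤w (fromℕ< (j<w i)) ⟩
    bitAt x ((toℕ (fromℕ< (j<w i)) + (w ∸ c)) % w)   ≡⟨ cong (λ t → bitAt x ((t + (w ∸ c)) % w)) (toℕ-fromℕ< (j<w i)) ⟩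
    bitAt x ((j i + (w ∸ c)) % w)                    ≡⟨ cong (bitAt x) (index i) ⟩
    bitAt x (toℕ i)                                  ≡⟨ bitAt-toℕ x i ⟩
    lookup x i                                       ∎

bitAt-zeroWord : ∀ w n → bitAt (zeroWord w) n ≡ false
bitAt-zeroWord zero    n       = refl
bitAt-zeroWord (suc w) zero    = refl
bitAt-zeroWord (suc w) (suc n) = bitAt-zeroWord w n

tabulate-false : ∀ {w} {f : Fin w → Bool} → (∀ i → f i ≡ false) → tabulate f ≡ zeroWord w
tabulate-false {w} f≡false =
  trans (tabulate-cong (λ i → trans (f≡false i) (sym (lookup-replicate i false))))
        (tabulate∘lookup (zeroWord w))

rotl-zeroWord : ∀ w c → rotl (zeroWord w) c ≡ zeroWord w
rotl-zeroWord w c = tabulate-false λ i →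
  trans (if-cong₂ (c ≤ᵇ toℕ i) (bitAt-zeroWord w _) (bitAt-zeroWord w _)) (if-eta (c ≤ᵇ toℕ i))

shl-zeroWord : ∀ w a → shl (zeroWord w) a ≡ zeroWord w
shl-zeroWord w a = tabulate-false λ i →
  trans (if-cong₂ (a ≤ᵇ toℕ i) (bitAt-zeroWord w _) refl) (if-eta (a ≤ᵇ toℕ i))

toNat-zeroWord : ∀ w → toNat (zeroWord w) ≡ 0
toNat-zeroWord zero    = refl
toNat-zeroWord (suc w) = cong (2 *_) (toNat-zeroWord w)

fromNat-zero : ∀ w → fromNat w 0 ≡ zeroWord w
fromNat-zero zero    = refl
fromNat-zero (suc w) = cong (false ∷_) (fromNat-zero w)

zeroWord-⊞-zeroWord : ∀ w → zeroWord w ⊞ zeroWord w ≡ zeroWord w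
zeroWord-⊞-zeroWord w =
  trans (cong₂ (λ m n → fromNat w (m + n)) (toNat-zeroWord w) (toNat-zeroWord w)) (fromNat-zero w)

-- The ++ scrambler

module _ {w : ℕ} (r : ℕ) where

  scramble : Word w × Word w → Word w
  scramble (p , q) = rotl (p ⊞ q) r ⊞ p

  unscramble : Word w → Word w → Word w
  unscramble p o = rotl (o ⊟ p) (w ∸ r) ⊟ p

  scramble-unscramble : r ≤ w → ∀ p o → scramble (p , unscramble p o) ≡ o
  scramble-unscramble r≤w p o = begin
    rotl (p ⊞ (rotl (o ⊟ p) (w ∸ r) ⊟ p)) r ⊞ p
      ≡⟨ cong (λ t → rotl t r ⊞ p) (⊞-comm p (rotl (o ⊟ p) (w ∸ r) ⊟ p)) ⟩
    rotl ((rotl (o ⊟ p) (w ∸ r) ⊟ p) ⊞ p) r ⊞ p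
      ≡⟨ cong (λ t → rotl t r ⊞ p) (⊟-⊞-cancel (rotl (o ⊟ p) (w ∸ r)) p) ⟩
    rotl (rotl (o ⊟ p) (w ∸ r)) r ⊞ p
      ≡⟨ cong (_⊞ p) (rotl-inverse (o ⊟ p) (w ∸ r) r (m∸n+n≡m r≤w)) ⟩
    (o ⊟ p) ⊞ p
      ≡⟨ ⊟-⊞-cancel o p ⟩
    o ∎
    where open ≡-Reasoning

  unscramble-scramble : r ≤ w → ∀ p q → unscramble p (scramble (p , q)) ≡ q
  unscramble-scramble r≤w p q = begin
    rotl ((rotl (p ⊞ q) r ⊞ p) ⊟ p) (w ∸ r) ⊟ p
      ≡⟨ cong (λ t → rotl t (w ∸ r) ⊟ p) (⊞-⊟-cancel (rotl (p ⊞ q) r) p) ⟩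
    rotl (rotl (p ⊞ q) r) (w ∸ r) ⊟ p
      ≡⟨ cong (_⊟ p) (rotl-inverse (p ⊞ q) r (w ∸ r) (m+[n∸m]≡n r≤w)) ⟩
    (p ⊞ q) ⊟ p
      ≡⟨ cong (_⊟ p) (⊞-comm p q) ⟩
    (q ⊞ p) ⊟ p
      ≡⟨ ⊞-⊟-cancel q p ⟩
    q ∎
    where open ≡-Reasoning

  scramble-zero : scramble (zeroWord w , zeroWord w) ≡ zeroWord w
  scramble-zero = begin
    rotl (zeroWord w ⊞ zeroWord w) r ⊞ zeroWord w
      ≡⟨ cong (λ t → rotl t r ⊞ zeroWord w) (zeroWord-⊞-zeroWord w) ⟩
    rotl (zeroWord w) r ⊞ zeroWord w
      ≡⟨ cong (_⊞ zeroWord w) (rotl-zeroWord w r) ⟩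
    zeroWord w ⊞ zeroWord w
      ≡⟨ zeroWord-⊞-zeroWord w ⟩
    zeroWord w ∎
    where open ≡-Reasoning

-- Sums over lists

𝟙 : ∀ {p} {P : Set p} → Dec P → ℕ
𝟙 P? = if does P? then 1 else 0

∑ : ∀ {A : Set} → (A → ℕ) → List A → ℕ
∑ f []       = 0
∑ f (x ∷ xs) = f x + ∑ f xs

syntax ∑ (λ x → e) xs = ∑[ x ∈ xs ] e

module _ {p q} {P : Set p} {Q : Set q} where

  𝟙-⇔ : (P → Q) → (Q → P) → (P? : Dec P) (Q? : Dec Q) → 𝟙 P? ≡ 𝟙 Q?
  𝟙-⇔ P→Q Q→P P? Q? = cong (if_then 1 else 0) (does-⇔ (mk⇔ P→Q Q→P) P? Q?)

  𝟙-× : (P? : Dec P) (Q? : Dec Q) → 𝟙 (P? ×-dec Q?) ≡ 𝟙 P? * 𝟙 Q?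
  𝟙-× P? Q? with does P? | does Q?
  ... | true  | true  = refl
  ... | true  | false = refl
  ... | false | _     = refl

𝟙-true : ∀ {p} {P : Set p} (P? : Dec P) → P → 𝟙 P? ≡ 1
𝟙-true P? p = cong (if_then 1 else 0) (dec-true P? p)

𝟙-¬-+-𝟙 : ∀ {p} {P : Set p} (P? : Dec P) → 𝟙 (¬? P?) + 𝟙 P? ≡ 1
𝟙-¬-+-𝟙 P? with does P?
... | true  = refl
... | false = refl

module _ {A : Set} where

  ∑-cong : ∀ {f g : A → ℕ} xs → (∀ x → f x ≡ g x) → ∑ f xs ≡ ∑ g xs
  ∑-cong []       _     = refl
  ∑-cong (x ∷ xs) f≗g = cong₂ _+_ (f≗g x) (∑-cong xs f≗g)

  ∑-++ : ∀ (f : A → ℕ) xs ys → ∑ f (xs ++ˡ ys) ≡ ∑ f xs + ∑ f ys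
  ∑-++ f []       ys = refl
  ∑-++ f (x ∷ xs) ys = trans (cong (f x +_) (∑-++ f xs ys)) (sym (+-assoc (f x) _ _))

  ∑-+ : ∀ (f g : A → ℕ) xs → ∑[ x ∈ xs ] (f x + g x) ≡ ∑ f xs + ∑ g xs
  ∑-+ f g []       = refl
  ∑-+ f g (x ∷ xs) = trans (cong (f x + g x +_) (∑-+ f g xs)) (+-interchange (f x) (g x) (∑ f xs) (∑ g xs))

  ∑-*ʳ : ∀ (f : A → ℕ) c xs → ∑[ x ∈ xs ] (f x * c) ≡ ∑ f xs * c
  ∑-*ʳ f c []       = refl
  ∑-*ʳ f c (x ∷ xs) = trans (cong (f x * c +_) (∑-*ʳ f c xs)) (sym (*-distribʳ-+ c (f x) (∑ f xs)))

  ∑-const : ∀ c (xs : List A) → ∑[ x ∈ xs ] c ≡ length xs * c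
  ∑-const c []       = refl
  ∑-const c (x ∷ xs) = cong (c +_) (∑-const c xs)

  ∑-1 : ∀ (xs : List A) → ∑[ x ∈ xs ] 1 ≡ length xs
  ∑-1 []       = refl
  ∑-1 (x ∷ xs) = cong suc (∑-1 xs)

  ∑-zero : ∀ (xs : List A) → ∑[ x ∈ xs ] 0 ≡ 0
  ∑-zero xs = trans (∑-const 0 xs) (*-zeroʳ (length xs))

∑-swap : ∀ {A B : Set} (F : A → B → ℕ) xs ys →
         ∑[ x ∈ xs ] ∑[ y ∈ ys ] F x y ≡ ∑[ y ∈ ys ] ∑[ x ∈ xs ] F x y
∑-swap F []       ys = sym (∑-zero ys)
∑-swap F (x ∷ xs) ys =
  trans (cong (∑ (F x) ys +_) (∑-swap F xs ys)) (sym (∑-+ (F x) (λ y → ∑[ x ∈ xs ] F x y) ys))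

∑-map : ∀ {A B : Set} (f : B → ℕ) (h : A → B) xs → ∑ f (map h xs) ≡ ∑[ x ∈ xs ] f (h x)
∑-map f h []       = refl
∑-map f h (x ∷ xs) = cong (f (h x) +_) (∑-map f h xs)

∑-concatMap : ∀ {A B : Set} (f : B → ℕ) (h : A → List B) xs →
              ∑ f (concatMap h xs) ≡ ∑[ x ∈ xs ] ∑ f (h x)
∑-concatMap f h []       = refl
∑-concatMap f h (x ∷ xs) = trans (∑-++ f (h x) (concatMap h xs)) (cong (∑ f (h x) +_) (∑-concatMap f h xs))

module _ {A : Set} (_≟_ : DecidableEquality A) where

  EnumeratesOnce : List A → Set
  EnumeratesOnce xs = ∀ a → ∑[ x ∈ xs ] 𝟙 (x ≟ a) ≡ 1

  module _ (xs : List A) (enum : EnumeratesOnce xs) where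

    ∑-𝟙-≟-* : ∀ (f : A → ℕ) a → ∑[ x ∈ xs ] (𝟙 (x ≟ a) * f x) ≡ f a
    ∑-𝟙-≟-* f a = begin
      ∑[ x ∈ xs ] (𝟙 (x ≟ a) * f x)  ≡⟨ ∑-cong xs pick ⟩
      ∑[ x ∈ xs ] (𝟙 (x ≟ a) * f a)  ≡⟨ ∑-*ʳ (λ x → 𝟙 (x ≟ a)) (f a) xs ⟩
      (∑[ x ∈ xs ] 𝟙 (x ≟ a)) * f a  ≡⟨ cong (_* f a) (enum a) ⟩
      1 * f a                        ≡⟨ *-identityˡ (f a) ⟩
      f a                            ∎
      where
      open ≡-Reasoning
      pick : ∀ x → 𝟙 (x ≟ a) * f x ≡ 𝟙 (x ≟ a) * f a
      pick x with x ≟ a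
      ... | yes refl = refl
      ... | no  _    = refl

    ∑-reindex : ∀ (σ : A ↔ A) (f : A → ℕ) → ∑[ x ∈ xs ] f (Inverse.to σ x) ≡ ∑ f xs
    ∑-reindex σ f = begin
      ∑[ x ∈ xs ] f (to x)
        ≡⟨ ∑-cong xs (λ x → ∑-𝟙-≟-* f (to x)) ⟨
      ∑[ x ∈ xs ] ∑[ y ∈ xs ] (𝟙 (y ≟ to x) * f y)
        ≡⟨ ∑-swap (λ x y → 𝟙 (y ≟ to x) * f y) xs xs ⟩
      ∑[ y ∈ xs ] ∑[ x ∈ xs ] (𝟙 (y ≟ to x) * f y)
        ≡⟨ ∑-cong xs (λ y → ∑-*ʳ (λ x → 𝟙 (y ≟ to x)) (f y) xs) ⟩
      ∑[ y ∈ xs ] ((∑[ x ∈ xs ] 𝟙 (y ≟ to x)) * f y)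
        ≡⟨ ∑-cong xs (λ y → cong (_* f y) (preimage y)) ⟩
      ∑[ y ∈ xs ] (1 * f y)
        ≡⟨ ∑-cong xs (λ y → *-identityˡ (f y)) ⟩
      ∑ f xs ∎
      where
      open ≡-Reasoning
      open Inverse σ
      preimage : ∀ y → ∑[ x ∈ xs ] 𝟙 (y ≟ to x) ≡ 1
      preimage y = trans (∑-cong xs λ x →
                            𝟙-⇔ (λ y≡to-x → trans (sym (strictlyInverseʳ x)) (cong from (sym y≡to-x)))
                                (λ x≡from-y → trans (sym (strictlyInverseˡ y)) (cong to (sym x≡from-y)))
                                (y ≟ to x) (x ≟ from y))
                         (enum (from y))

module _ {A : Set} (xs : List A) where

  enumeratesOnce-allVecs : (_≟_ : DecidableEquality A) → EnumeratesOnce _≟_ xs →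
                           ∀ n → EnumeratesOnce (≡-dec _≟_) (allVecs xs n)
  enumeratesOnce-allVecs _≟_ enum zero    []       = refl
  enumeratesOnce-allVecs _≟_ enum (suc n) (a ∷ as) = begin
    ∑[ v ∈ allVecs xs (suc n) ] 𝟙 (v ≟ᵥ (a ∷ as))
      ≡⟨ ∑-concatMap _ (λ x → map (x ∷_) vs) xs ⟩
    ∑[ x ∈ xs ] ∑ (λ v → 𝟙 (v ≟ᵥ (a ∷ as))) (map (x ∷_) vs)
      ≡⟨ ∑-cong xs (λ x → ∑-map _ (x ∷_) vs) ⟩
    ∑[ x ∈ xs ] ∑[ v ∈ vs ] 𝟙 ((x ∷ v) ≟ᵥ (a ∷ as))
      ≡⟨ ∑-cong xs (λ x → ∑-cong vs (split x)) ⟩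
    ∑[ x ∈ xs ] ∑[ v ∈ vs ] (𝟙 (v ≟ᵥ as) * 𝟙 (x ≟ a))
      ≡⟨ ∑-cong xs (λ x → ∑-*ʳ (λ v → 𝟙 (v ≟ᵥ as)) (𝟙 (x ≟ a)) vs) ⟩
    ∑[ x ∈ xs ] ((∑[ v ∈ vs ] 𝟙 (v ≟ᵥ as)) * 𝟙 (x ≟ a))
      ≡⟨ ∑-cong xs (λ x → cong (_* 𝟙 (x ≟ a)) (enumeratesOnce-allVecs _≟_ enum n as)) ⟩
    ∑[ x ∈ xs ] (1 * 𝟙 (x ≟ a))
      ≡⟨ ∑-cong xs (λ x → *-identityˡ (𝟙 (x ≟ a))) ⟩
    ∑[ x ∈ xs ] 𝟙 (x ≟ a)
      ≡⟨ enum a ⟩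
    1 ∎
    where
    open ≡-Reasoning
    vs = allVecs xs n
    _≟ᵥ_ : ∀ {n} → DecidableEquality (Vec A n)
    _≟ᵥ_ = ≡-dec _≟_
    split : ∀ x v → 𝟙 ((x ∷ v) ≟ᵥ (a ∷ as)) ≡ 𝟙 (v ≟ᵥ as) * 𝟙 (x ≟ a)
    split x v = trans (𝟙-⇔ (λ eq → let x≡a , v≡as = ∷-injective eq in v≡as , x≡a)
                           (λ (v≡as , x≡a) → cong₂ _∷_ x≡a v≡as)
                           ((x ∷ v) ≟ᵥ (a ∷ as)) (v ≟ᵥ as ×-dec x ≟ a))
                      (𝟙-× (v ≟ᵥ as) (x ≟ a))

  ∑-allVecs-+ : ∀ m n (f : Vec A (m + n) → ℕ) →
                ∑ f (allVecs xs (m + n)) ≡ ∑[ u ∈ allVecs xs m ] ∑[ v ∈ allVecs xs n ] f (u ++ v)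
  ∑-allVecs-+ zero    n f = sym (+-identityʳ _)
  ∑-allVecs-+ (suc m) n f = begin
    ∑ f (allVecs xs (suc m + n))
      ≡⟨ ∑-concatMap f _ xs ⟩
    ∑[ x ∈ xs ] ∑ f (map (x ∷_) (allVecs xs (m + n)))
      ≡⟨ ∑-cong xs (λ x → ∑-map f (x ∷_) (allVecs xs (m + n))) ⟩
    ∑[ x ∈ xs ] ∑[ y ∈ allVecs xs (m + n) ] f (x ∷ y)
      ≡⟨ ∑-cong xs (λ x → ∑-allVecs-+ m n (λ y → f (x ∷ y))) ⟩
    ∑[ x ∈ xs ] ∑[ u ∈ allVecs xs m ] ∑[ v ∈ allVecs xs n ] f (x ∷ u ++ v)
      ≡⟨ ∑-cong xs (λ x → ∑-map _ (x ∷_) (allVecs xs m)) ⟨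
    ∑[ x ∈ xs ] ∑ (λ u → ∑[ v ∈ allVecs xs n ] f (u ++ v)) (map (x ∷_) (allVecs xs m))
      ≡⟨ ∑-concatMap _ _ xs ⟨
    ∑[ u ∈ allVecs xs (suc m) ] ∑[ v ∈ allVecs xs n ] f (u ++ v) ∎
    where open ≡-Reasoning

  length-allVecs : ∀ n → length (allVecs xs n) ≡ length xs ^ n
  length-allVecs zero    = refl
  length-allVecs (suc n) = begin
    length (allVecs xs (suc n))
      ≡⟨ ∑-1 (allVecs xs (suc n)) ⟨
    ∑[ v ∈ allVecs xs (suc n) ] 1
      ≡⟨ ∑-concatMap _ (λ x → map (x ∷_) (allVecs xs n)) xs ⟩
    ∑[ x ∈ xs ] ∑ (λ _ → 1) (map (x ∷_) (allVecs xs n))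
      ≡⟨ ∑-cong xs (λ x → ∑-map _ (x ∷_) (allVecs xs n)) ⟩
    ∑[ x ∈ xs ] ∑[ v ∈ allVecs xs n ] 1
      ≡⟨ ∑-cong xs (λ x → ∑-1 (allVecs xs n)) ⟩
    ∑[ x ∈ xs ] length (allVecs xs n)
      ≡⟨ ∑-cong xs (λ x → length-allVecs n) ⟩
    ∑[ x ∈ xs ] (length xs ^ n)
      ≡⟨ ∑-const (length xs ^ n) xs ⟩
    length xs * length xs ^ n ∎
    where open ≡-Reasoning

length-filter : ∀ {A : Set} {p} {P : Pred A p} (P? : Decidable P) xs →
                length (filter P? xs) ≡ ∑[ x ∈ xs ] 𝟙 (P? x)
length-filter P? []       = refl
length-filter P? (x ∷ xs) with does (P? x)
... | true  = cong suc (length-filter P? xs)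
... | false = length-filter P? xs

-- Equidistribution from a change of coordinates

enumeratesOnce-allWords : ∀ w → EnumeratesOnce _≟W_ (allWords w)
enumeratesOnce-allWords = enumeratesOnce-allVecs (true ∷ false ∷ []) Bool._≟_ λ where
  true  → refl
  false → refl

length-allWords : ∀ w → length (allWords w) ≡ 2 ^ w
length-allWords = length-allVecs (true ∷ false ∷ [])

zeroWords : ∀ w n → Vec (Word w) n
zeroWords w n = replicate n (zeroWord w)

++-zeroWords : ∀ {w m n} (u : Vec (Word w) m) (v : Vec (Word w) n) →
               u ++ v ≡ zeroWords w (m + n) → u ≡ zeroWords w m × v ≡ zeroWords w n
++-zeroWords []      v eq = refl , eq
++-zeroWords (x ∷ u) v eq = let x≡0 , u++v≡0 = ∷-injective eq; u≡0 , v≡0 = ++-zeroWords u v u++v≡0 in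
  cong₂ _∷_ x≡0 u≡0 , v≡0

zeroWords-++ : ∀ {w} m n → zeroWords w m ++ zeroWords w n ≡ zeroWords w (m + n)
zeroWords-++ zero    n = refl
zeroWords-++ (suc m) n = cong (_ ∷_) (zeroWords-++ m n)

drop-++ : ∀ {A : Set} {m n} (u : Vec A m) (v : Vec A n) → drop m (u ++ v) ≡ v
drop-++ []      v = refl
drop-++ (x ∷ u) v = drop-++ u v

module _ {w m d : ℕ} (next : State w (m + d) → State w (m + d)) (φ : State w (m + d) → Word w)
         (Φ : State w (m + d) ↔ State w (m + d))
         (Φ-zero : Inverse.to Φ (zeroWords w (m + d)) ≡ zeroWords w (m + d))
         (drop-Φ : ∀ s → drop m (Inverse.to Φ s) ≡ outputs next φ d s) where

  open Inverse Φ

  private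
    words : ∀ n → List (Vec (Word w) n)
    words n = allVecs (allWords w) n

    enum : ∀ n → EnumeratesOnce _≟S_ (words n)
    enum = enumeratesOnce-allVecs (allWords w) _≟W_ (enumeratesOnce-allWords w)

    outputs-from : ∀ u v → outputs next φ d (from (u ++ v)) ≡ v
    outputs-from u v = begin
      outputs next φ d (from (u ++ v))  ≡⟨ drop-Φ (from (u ++ v)) ⟨
      drop m (to (from (u ++ v)))       ≡⟨ cong (drop m) (strictlyInverseˡ (u ++ v)) ⟩
      drop m (u ++ v)                   ≡⟨ drop-++ u v ⟩
      v                                  ∎
      where open ≡-Reasoning

    from-zero⇒zero : ∀ x → from x ≡ zeroWords w (m + d) → x ≡ zeroWords w (m + d)
    from-zero⇒zero x eq = trans (sym (strictlyInverseˡ x)) (trans (cong to eq) Φ-zero)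

    zero⇒from-zero : ∀ x → x ≡ zeroWords w (m + d) → from x ≡ zeroWords w (m + d)
    zero⇒from-zero x refl = trans (cong from (sym Φ-zero)) (strictlyInverseʳ _)

    -- Reindexing along from: the states with outputs t are exactly the from (u ++ t).
    count≡∑ : ∀ t → count next φ d t ≡ ∑[ u ∈ words m ] 𝟙 (¬? ((u ++ t) ≟S zeroWords w (m + d)))
    count≡∑ t = begin
      count next φ d t
        ≡⟨ length-filter P? (words (m + d)) ⟩
      ∑[ s ∈ words (m + d) ] 𝟙 (P? s)
        ≡⟨ ∑-reindex _≟S_ (words (m + d)) (enum (m + d)) (↔-sym Φ) (λ s → 𝟙 (P? s)) ⟨
      ∑[ x ∈ words (m + d) ] 𝟙 (P? (from x))
        ≡⟨ ∑-allVecs-+ (allWords w) m d (λ x → 𝟙 (P? (from x))) ⟩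
      ∑[ u ∈ words m ] ∑[ v ∈ words d ] 𝟙 (P? (from (u ++ v)))
        ≡⟨ ∑-cong (words m) (λ u → ∑-cong (words d) (split u)) ⟩
      ∑[ u ∈ words m ] ∑[ v ∈ words d ] (𝟙 (v ≟S t) * 𝟙 (nonzero (u ++ v)))
        ≡⟨ ∑-cong (words m) (λ u → ∑-𝟙-≟-* _≟S_ (words d) (enum d) (λ v → 𝟙 (nonzero (u ++ v))) t) ⟩
      ∑[ u ∈ words m ] 𝟙 (nonzero (u ++ t)) ∎
      where
      open ≡-Reasoning
      nonzero : (x : Vec (Word w) (m + d)) → Dec (¬ x ≡ zeroWords w (m + d))
      nonzero x = ¬? (x ≟S zeroWords w (m + d))
      P? : (s : State w (m + d)) → Dec (¬ s ≡ zeroWords w (m + d) × outputs next φ d s ≡ t)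
      P? s = nonzero s ×-dec (outputs next φ d s ≟S t)
      split : ∀ u v → 𝟙 (P? (from (u ++ v))) ≡ 𝟙 (v ≟S t) * 𝟙 (nonzero (u ++ v))
      split u v = trans (𝟙-⇔ (λ (≢0 , out≡t) → trans (sym (outputs-from u v)) out≡t ,
                                                 λ ≡0 → ≢0 (zero⇒from-zero _ ≡0))
                             (λ (v≡t , ≢0) → (λ ≡0 → ≢0 (from-zero⇒zero _ ≡0)) ,
                                             trans (outputs-from u v) v≡t)
                             (P? (from (u ++ v))) ((v ≟S t) ×-dec nonzero (u ++ v)))
                        (𝟙-× (v ≟S t) (nonzero (u ++ v)))

  equidistributed-by-coordinates : Equidistributed w (m + d) next φ d
  equidistributed-by-coordinates t = nonzero-tuple , zero-tuple
    where
    open ≡-Reasoning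
    0ᵐ = zeroWords w m
    nonzero : ∀ {n} (x : Vec (Word w) n) → Dec (¬ x ≡ zeroWords w n)
    nonzero x = ¬? (x ≟S zeroWords w _)

    #words : length (words m) ≡ 2 ^ (w * (m + d ∸ d))
    #words = begin
      length (words m)        ≡⟨ length-allVecs (allWords w) m ⟩
      length (allWords w) ^ m ≡⟨ cong (_^ m) (length-allWords w) ⟩
      (2 ^ w) ^ m             ≡⟨ ^-*-assoc 2 w m ⟩
      2 ^ (w * m)             ≡⟨ cong (λ k → 2 ^ (w * k)) (m+n∸n≡m m d) ⟨
      2 ^ (w * (m + d ∸ d))   ∎

    nonzero-tuple : t ≢ zeroWords w d → count next φ d t ≡ 2 ^ (w * (m + d ∸ d))
    nonzero-tuple t≢0 = begin
      count next φ d t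
        ≡⟨ count≡∑ t ⟩
      ∑[ u ∈ words m ] 𝟙 (nonzero (u ++ t))
        ≡⟨ ∑-cong (words m) (λ u → 𝟙-true (nonzero (u ++ t)) (λ eq → t≢0 (proj₂ (++-zeroWords u t eq)))) ⟩
      ∑[ u ∈ words m ] 1
        ≡⟨ ∑-1 (words m) ⟩
      length (words m)
        ≡⟨ #words ⟩
      2 ^ (w * (m + d ∸ d)) ∎

    zero-tuple : t ≡ zeroWords w d → count next φ d t ≡ 2 ^ (w * (m + d ∸ d)) ∸ 1
    zero-tuple refl = begin
      count next φ d t
        ≡⟨ count≡∑ t ⟩
      ∑[ u ∈ words m ] 𝟙 (nonzero (u ++ t))
        ≡⟨ ∑-cong (words m) prefix ⟩
      ∑[ u ∈ words m ] 𝟙 (nonzero u)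
        ≡⟨ m+n∸n≡m _ 1 ⟨
      ∑[ u ∈ words m ] 𝟙 (nonzero u) + 1 ∸ 1
        ≡⟨ cong (λ k → ∑[ u ∈ words m ] 𝟙 (nonzero u) + k ∸ 1) (enum m 0ᵐ) ⟨
      ∑[ u ∈ words m ] 𝟙 (nonzero u) + ∑[ u ∈ words m ] 𝟙 (u ≟S 0ᵐ) ∸ 1
        ≡⟨ cong (_∸ 1) (∑-+ _ _ (words m)) ⟨
      ∑[ u ∈ words m ] (𝟙 (nonzero u) + 𝟙 (u ≟S 0ᵐ)) ∸ 1
        ≡⟨ cong (_∸ 1) (∑-cong (words m) (λ u → 𝟙-¬-+-𝟙 (u ≟S 0ᵐ))) ⟩
      ∑[ u ∈ words m ] 1 ∸ 1
        ≡⟨ cong (_∸ 1) (trans (∑-1 (words m)) #words) ⟩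
      2 ^ (w * (m + d ∸ d)) ∸ 1 ∎
      where
      prefix : ∀ u → 𝟙 (nonzero (u ++ t)) ≡ 𝟙 (nonzero u)
      prefix u = 𝟙-⇔ (λ u++0≢0 u≡0 → u++0≢0 (trans (cong (_++ t) u≡0) (zeroWords-++ m d)))
                     (λ u≢0 u++0≡0 → u≢0 (proj₁ (++-zeroWords u t u++0≡0)))
                     (nonzero (u ++ t)) (nonzero u)

-- Coordinates for xoshiro

module _ {w : ℕ} (a b r : ℕ) (b≤w : b ≤ w) (r≤w : r ≤ w) where

  private
    next : State w 4 → State w 4
    next = xoshiroNext a b

    R R⁻¹ : Word w → Word w
    R x = rotl x b
    R⁻¹ x = rotl x (w ∸ b)

    R-R⁻¹ : ∀ x → R (R⁻¹ x) ≡ x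
    R-R⁻¹ x = rotl-inverse x (w ∸ b) b (m∸n+n≡m b≤w)

    R⁻¹-R : ∀ x → R⁻¹ (R x) ≡ x
    R⁻¹-R x = rotl-inverse x b (w ∸ b) (m+[n∸m]≡n b≤w)

  Ends : Set
  Ends = Word w × Word w

  ends : State w 4 → Ends
  ends (s₀ ∷ _ ∷ _ ∷ s₃ ∷ []) = s₀ , s₃

  prev : Ends → Word w
  prev (x , y) = x ⊕ R⁻¹ y

  prev-ends-next : ∀ s → prev (ends (next s)) ≡ proj₁ (ends s)
  prev-ends-next (s₀ ∷ s₁ ∷ s₂ ∷ s₃ ∷ []) = begin
    (s₀ ⊕ s₁ ⊕ s₃) ⊕ R⁻¹ (R (s₁ ⊕ s₃))  ≡⟨ cong ((s₀ ⊕ s₁ ⊕ s₃) ⊕_) (R⁻¹-R (s₁ ⊕ s₃)) ⟩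
    (s₀ ⊕ s₁ ⊕ s₃) ⊕ (s₁ ⊕ s₃)         ≡⟨ cong (_⊕ (s₁ ⊕ s₃)) (⊕-assoc s₀ s₁ s₃) ⟩
    s₀ ⊕ (s₁ ⊕ s₃) ⊕ (s₁ ⊕ s₃)         ≡⟨ ⊕-cancelʳ s₀ (s₁ ⊕ s₃) ⟩
    s₀                                 ∎
    where open ≡-Reasoning

  rotatedWord : State w 4 → Word w
  rotatedWord (_ ∷ s₁ ∷ _ ∷ s₃ ∷ []) = s₁ ⊕ s₃

  ends-next : ∀ s {x y} → proj₁ (ends s) ≡ prev (x , y) → rotatedWord s ≡ R⁻¹ y → ends (next s) ≡ (x , y)
  ends-next (s₀ ∷ s₁ ∷ s₂ ∷ s₃ ∷ []) {x} {y} s₀≡prev s₁⊕s₃≡R⁻¹y = cong₂ _,_ first last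
    where
    open ≡-Reasoning
    first : s₀ ⊕ s₁ ⊕ s₃ ≡ x
    first = begin
      s₀ ⊕ s₁ ⊕ s₃          ≡⟨ ⊕-assoc s₀ s₁ s₃ ⟩
      s₀ ⊕ (s₁ ⊕ s₃)        ≡⟨ cong₂ _⊕_ s₀≡prev s₁⊕s₃≡R⁻¹y ⟩
      x ⊕ R⁻¹ y ⊕ R⁻¹ y     ≡⟨ ⊕-cancelʳ x (R⁻¹ y) ⟩
      x                     ∎
    last : R (s₁ ⊕ s₃) ≡ y
    last = trans (cong R s₁⊕s₃≡R⁻¹y) (R-R⁻¹ y)

  Ends³ : Set
  Ends³ = Ends × Ends × Ends

  ends³ : State w 4 → Ends³
  ends³ s = ends s , ends (next s) , ends (next (next s))

  Linked : Ends³ → Set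
  Linked (e₀ , e₁ , e₂) = proj₁ e₀ ≡ prev e₁ × proj₁ e₁ ≡ prev e₂

  ends³-linked : ∀ s → Linked (ends³ s)
  ends³-linked s = sym (prev-ends-next s) , sym (prev-ends-next (next s))

  -- s₁ and s₂ are read off from y₁ = R (s₁ ⊕ s₃) and y₂ = R (s₁′ ⊕ y₁), where s₁′ = s₀ ⊕ s₁ ⊕ s₂
  -- is the second word of the next state.
  assemble : Ends³ → State w 4
  assemble ((x₀ , y₀) , (_ , y₁) , (_ , y₂)) = x₀ ∷ s₁ ∷ x₀ ⊕ s₁ ⊕ (R⁻¹ y₂ ⊕ y₁) ∷ y₀ ∷ []
    where s₁ = R⁻¹ y₁ ⊕ y₀

  assemble-ends³ : ∀ s → assemble (ends³ s) ≡ s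
  assemble-ends³ (s₀ ∷ s₁ ∷ s₂ ∷ s₃ ∷ []) =
    cong₂ (λ u v → s₀ ∷ u ∷ v ∷ s₃ ∷ []) s₁≡
          (trans (cong₂ (λ u v → s₀ ⊕ u ⊕ v) s₁≡ t₁≡) (⊕-cancelˡ (s₀ ⊕ s₁) s₂))
    where
    R⁻¹R-⊕-cancel : ∀ x y → R⁻¹ (R (x ⊕ y)) ⊕ y ≡ x
    R⁻¹R-⊕-cancel x y = trans (cong (_⊕ y) (R⁻¹-R (x ⊕ y))) (⊕-cancelʳ x y)
    s₁≡ : R⁻¹ (R (s₁ ⊕ s₃)) ⊕ s₃ ≡ s₁
    s₁≡ = R⁻¹R-⊕-cancel s₁ s₃
    t₁≡ : R⁻¹ (R (s₀ ⊕ s₁ ⊕ s₂ ⊕ R (s₁ ⊕ s₃))) ⊕ R (s₁ ⊕ s₃) ≡ s₀ ⊕ s₁ ⊕ s₂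
    t₁≡ = R⁻¹R-⊕-cancel (s₀ ⊕ s₁ ⊕ s₂) (R (s₁ ⊕ s₃))

  ends³-assemble : ∀ E → Linked E → ends³ (assemble E) ≡ E
  ends³-assemble E@((x₀ , y₀) , (x₁ , y₁) , (x₂ , y₂)) (x₀≡ , x₁≡) = cong₂ _,_ refl (cong₂ _,_ step₁ step₂)
    where
    s₁ = R⁻¹ y₁ ⊕ y₀
    t₁ = R⁻¹ y₂ ⊕ y₁
    step₁ : ends (next (assemble E)) ≡ (x₁ , y₁)
    step₁ = ends-next (assemble E) x₀≡ (⊕-cancelʳ (R⁻¹ y₁) y₀)
    step₂ : ends (next (next (assemble E))) ≡ (x₂ , y₂)
    step₂ = ends-next (next (assemble E)) (trans (cong proj₁ step₁) x₁≡)
              (trans (cong₂ _⊕_ (⊕-cancelˡ (x₀ ⊕ s₁) t₁) (cong proj₂ step₁)) (⊕-cancelʳ (R⁻¹ y₂) y₁))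

  back : Ends → Word w → Ends
  back e o = prev e , unscramble r (prev e) o

  observe : Ends³ → Vec (Word w) 4
  observe (e₀ , e₁ , e₂) = proj₁ e₂ ∷ scramble r e₀ ∷ scramble r e₁ ∷ scramble r e₂ ∷ []

  recover : Vec (Word w) 4 → Ends³
  recover (p ∷ o₀ ∷ o₁ ∷ o₂ ∷ []) = e₀ , e₁ , e₂
    where
    e₂ = p , unscramble r p o₂
    e₁ = back e₂ o₁
    e₀ = back e₁ o₀

  recover-linked : ∀ o → Linked (recover o)
  recover-linked (p ∷ o₀ ∷ o₁ ∷ o₂ ∷ []) = refl , refl

  observe-recover : ∀ o → observe (recover o) ≡ o
  observe-recover (p ∷ o₀ ∷ o₁ ∷ o₂ ∷ []) =
    cong₂ (λ u v → p ∷ u ∷ v) (scramble-back e₁ o₀)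
      (cong₂ (λ u v → u ∷ v ∷ []) (scramble-back e₂ o₁) (scramble-unscramble r r≤w p o₂))
    where
    scramble-back : ∀ e o → scramble r (back e o) ≡ o
    scramble-back e o = scramble-unscramble r r≤w (prev e) o
    e₂ = p , unscramble r p o₂
    e₁ = back e₂ o₁

  back-scramble : ∀ e e′ → proj₁ e ≡ prev e′ → back e′ (scramble r e) ≡ e
  back-scramble (x , y) e′ refl = cong (x ,_) (unscramble-scramble r r≤w x y)

  recover-observe : ∀ E → Linked E → recover (observe E) ≡ E
  recover-observe (e₀ , e₁ , (x₂ , y₂)) (x₀≡ , x₁≡) = cong₂ _,_ e₀≡ (cong₂ _,_ e₁≡ e₂≡)
    where
    e₂≡ : (x₂ , unscramble r x₂ (scramble r (x₂ , y₂))) ≡ (x₂ , y₂)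
    e₂≡ = cong (x₂ ,_) (unscramble-scramble r r≤w x₂ y₂)
    e₁≡ = trans (cong (λ e → back e (scramble r e₁)) e₂≡) (back-scramble e₁ (x₂ , y₂) x₁≡)
    e₀≡ = trans (cong (λ e → back e (scramble r e₀)) e₁≡) (back-scramble e₀ e₁ x₀≡)

  coordinates : State w 4 ↔ State w 4
  coordinates = mk↔ₛ′ (observe ∘ ends³) (assemble ∘ recover) inverseˡ inverseʳ
    where
    open ≡-Reasoning
    inverseˡ : ∀ o → observe (ends³ (assemble (recover o))) ≡ o
    inverseˡ o = begin
      observe (ends³ (assemble (recover o))) ≡⟨ cong observe (ends³-assemble (recover o) (recover-linked o)) ⟩
      observe (recover o)                    ≡⟨ observe-recover o ⟩
      o                                      ∎
    inverseʳ : ∀ s → assemble (recover (observe (ends³ s))) ≡ s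
    inverseʳ s = begin
      assemble (recover (observe (ends³ s))) ≡⟨ cong assemble (recover-observe (ends³ s) (ends³-linked s)) ⟩
      assemble (ends³ s)                     ≡⟨ assemble-ends³ s ⟩
      s                                      ∎

  drop-coordinates : ∀ s → drop 1 (observe (ends³ s)) ≡ outputs next (plusplus r) 3 s
  drop-coordinates (s₀ ∷ s₁ ∷ s₂ ∷ s₃ ∷ []) = refl

  next-zero : next (zeroWords w 4) ≡ zeroWords w 4
  next-zero = cong₂ _∷_ 0⊕0⊕0 (cong₂ _∷_ 0⊕0⊕0 (cong₂ _∷_ 0⊕0⊕shl0 (cong (_∷ []) rotl[0⊕0])))
    where
    0ʷ = zeroWord w
    0⊕0 : 0ʷ ⊕ 0ʷ ≡ 0ʷ
    0⊕0 = ⊕-identityʳ 0ʷ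
    0⊕0⊕0 : 0ʷ ⊕ 0ʷ ⊕ 0ʷ ≡ 0ʷ
    0⊕0⊕0 = trans (cong (_⊕ 0ʷ) 0⊕0) 0⊕0
    0⊕0⊕shl0 : 0ʷ ⊕ 0ʷ ⊕ shl 0ʷ a ≡ 0ʷ
    0⊕0⊕shl0 = trans (cong₂ _⊕_ 0⊕0 (shl-zeroWord w a)) 0⊕0
    rotl[0⊕0] : rotl (0ʷ ⊕ 0ʷ) b ≡ 0ʷ
    rotl[0⊕0] = trans (cong (λ x → rotl x b) 0⊕0) (rotl-zeroWord w b)

  coordinates-zero : observe (ends³ (zeroWords w 4)) ≡ zeroWords w 4
  coordinates-zero = begin
    observe (ends³ 0ˢ)
      ≡⟨ cong (λ s → observe (ends 0ˢ , ends s , ends (next s))) next-zero ⟩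
    observe (ends 0ˢ , ends 0ˢ , ends (next 0ˢ))
      ≡⟨ cong (λ s → observe (ends 0ˢ , ends 0ˢ , ends s)) next-zero ⟩
    observe (ends 0ˢ , ends 0ˢ , ends 0ˢ)
      ≡⟨ cong (λ o → zeroWord w ∷ o ∷ o ∷ o ∷ []) (scramble-zero r) ⟩
    0ˢ ∎
    where
    open ≡-Reasoning
    0ˢ = zeroWords w 4

proposition8p5 : ∀ (w a b r : ℕ) → 1 ≤ w → a < w → b < w → r < w →
    Equidistributed w 4 (xoshiroNext a b) (plusplus r) 3
proposition8p5 w a b r _ _ b<w r<w =
  equidistributed-by-coordinates {m = 1} {d = 3} (xoshiroNext a b) (plusplus r)
    (coordinates a b r b≤w r≤w) (coordinates-zero a b r b≤w r≤w) (drop-coordinates a b r b≤w r≤w)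
  where
  b≤w = <⇒≤ b<w
  r≤w = <⇒≤ r<w
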